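{- Let $\mathbf A$ be an integral FL${}_{\mathrm e}$-algebra. The following are equivalent: (1) $\mathbf A\in \mathbf G_{\mathsf{FL}_{\mathsf{ei}}}(\mathsf{BA})$; (2) $\mathbf A$ is strongly pseudo-complemented, i.e. $\neg x\wedge\neg(x\to y)\leq 0$ for all $x,y\in A$; (3) $\mathbf A$ satisfies $\neg(x\to y)=\neg(\neg x\vee y)$ for all $x,y\in A$.
   Context: An FL${}_{\mathrm e}$-algebra is an algebra $\langle A,\wedge,\vee,\cdot,\to,0,1\rangle$ such that $\langle A,\wedge,\vee\rangle$ is a lattice (with order $\leq$), $\langle A,\cdot,1\rangle$ is a commutative monoid, $0$ is an arbitrary constant, and $x\cdot y\leq z \iff x\leq y\to z$. It is integral if $1$ is its greatest element. Write $\neg x:=x\to 0$. $\mathsf{FL}_{\mathsf e}$ denotes the variety of all FL${}_{\mathrm e}$-algebras and $\mathsf{FL}_{\mathsf{ei}}$ the subvariety of integral ones. $\mathsf{BA}$ denotes the variety of Boolean algebras, viewed as the FL${}_{\mathrm e}$-algebras satisfying $x\cdot y= x\wedge y$ and $x\to y=\neg x\vee y$. $\mathbf G_{\mathsf{FL}_{\mathsf e}}(\mathsf{BA})$ is the largest subvariety $\mathsf W$ of $\mathsf{FL}_{\mathsf e}$ such that for every equation $s\approx t$ in the language of FL${}_{\mathrm e}$-algebras, $\mathsf{BA}\models s\approx t$ iff $\mathsf W\models \neg s\approx\neg t$; and $\mathbf G_{\mathsf{FL}_{\mathsf{ei}}}(\mathsf{BA}):=\mathbf G_{\mathsf{FL}_{\mathsf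 e}}(\mathsf{BA})\cap\mathsf{FL}_{\mathsf{ei}}$. -}

module Defs where

open import Data.Nat using (ℕ)
open import Data.Product using (Σ; _×_)
open import Relation.Binary.PropositionalEquality using (_≡_)
open import Function.Bundles using (_⇔_)

record FLe : Set₁ where
  infixr 6 _∧_
  infixr 5 _∨_
  infixl 7 _·_
  infixr 4 _⇒_
  field
    Carrier : Set
    _∧_ _∨_ _·_ _⇒_ : Carrier → Carrier → Carrier
    𝟘 𝟙 : Carrier
    ∧-assoc : ∀ x y z → (x ∧ y) ∧ z ≡ x ∧ (y ∧ z)
    ∨-assoc : ∀ x y z → (x ∨ y) ∨ z ≡ x ∨ (y ∨ z)
    ∧-comm  : ∀ x y → x ∧ y ≡ y ∧ x
    ∨-comm  : ∀ x y → x ∨ y ≡ y ∨ x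
    ∧-absorbs-∨ : ∀ x y → x ∧ (x ∨ y) ≡ x
    ∨-absorbs-∧ : ∀ x y → x ∨ (x ∧ y) ≡ x
    ·-assoc : ∀ x y z → (x · y) · z ≡ x · (y · z)
    ·-comm  : ∀ x y → x · y ≡ y · x
    ·-identityˡ : ∀ x → 𝟙 · x ≡ x
  infix 3 _≤_
  _≤_ : Carrier → Carrier → Set
  x ≤ y = x ∧ y ≡ x
  field
    residuated : ∀ x y z → ((x · y) ≤ z) ⇔ (x ≤ (y ⇒ z))
  ¬ₐ : Carrier → Carrier
  ¬ₐ x = x ⇒ 𝟘

open FLe public using (Carrier)

Integral : FLe → Set
Integral A = ∀ x → x ≤ 𝟙
  where open FLe A

IsBA : FLe → Set
IsBA A = (∀ x y → x · y ≡ x ∧ y) × (∀ x y → (x ⇒ y) ≡ (¬ₐ x ∨ y))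
  where open FLe A

data Term : Set where
  var : ℕ → Term
  _∧ₜ_ _∨ₜ_ _·ₜ_ _⇒ₜ_ : Term → Term → Term
  𝟘ₜ 𝟙ₜ : Term

¬ₜ : Term → Term
¬ₜ s = s ⇒ₜ 𝟘ₜ

⟦_⟧ : Term → (A : FLe) → (ℕ → Carrier A) → Carrier A
⟦ var i ⟧ A v = v i
⟦ s ∧ₜ t ⟧ A v = FLe._∧_ A (⟦ s ⟧ A v) (⟦ t ⟧ A v)
⟦ s ∨ₜ t ⟧ A v = FLe._∨_ A (⟦ s ⟧ A v) (⟦ t ⟧ A v)
⟦ s ·ₜ t ⟧ A v = FLe._·_ A (⟦ s ⟧ A v) (⟦ t ⟧ A v)
⟦ s ⇒ₜ t ⟧ A v = FLe._⇒_ A (⟦ s ⟧ A v) (⟦ t ⟧ A v)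
⟦ 𝟘ₜ ⟧ A v = FLe.𝟘 A
⟦ 𝟙ₜ ⟧ A v = FLe.𝟙 A

_⊨_≈_ : FLe → Term → Term → Set
A ⊨ s ≈ t = ∀ (v : ℕ → Carrier A) → ⟦ s ⟧ A v ≡ ⟦ t ⟧ A v

BA⊨_≈_ : Term → Term → Set₁
BA⊨ s ≈ t = ∀ (B : FLe) → IsBA B → B ⊨ s ≈ t

-- Subvarieties of FL_e, given as equational classes Mod(E)
-- (Birkhoff), where E is a set of equations.

Equations : Set₁
Equations = Term → Term → Set

_⊨ᴱ_ : FLe → Equations → Set
A ⊨ᴱ E = ∀ s t → E s t → A ⊨ s ≈ t

Mod_⊨_≈_ : Equations → Term → Term → Set₁
Mod E ⊨ s ≈ t = ∀ (B : FLe) → B ⊨ᴱ E → B ⊨ s ≈ t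

GlivenkoProperty : Equations → Set₁
GlivenkoProperty E = ∀ s t → (BA⊨ s ≈ t) ⇔ (Mod E ⊨ ¬ₜ s ≈ ¬ₜ t)

-- A ∈ G_{FL_e}(BA): A lies in the largest subvariety W with the Glivenko
-- property; equivalently (as it is the largest, i.e. contains every such
-- subvariety) A lies in some subvariety with the Glivenko property.
InG-FLe-BA : FLe → Set₁
InG-FLe-BA A = Σ Equations (λ E → GlivenkoProperty E × (A ⊨ᴱ E))

-- A ∈ G_{FL_ei}(BA) = G_{FL_e}(BA) ∩ FL_ei
InG-FLei-BA : FLe → Set₁
InG-FLei-BA A = InG-FLe-BA A × Integral A

StronglyPseudoComplemented : FLe → Set
StronglyPseudoComplemented A = ∀ x y → (¬ₐ x ∧ ¬ₐ (x ⇒ y)) ≤ 𝟘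
  where open FLe A

NegImpIdentity : FLe → Set
NegImpIdentity A = ∀ x y → ¬ₐ (x ⇒ y) ≡ ¬ₐ (¬ₐ x ∨ y)
  where open FLe A

-- In an integral FLe-algebra, strong pseudo-complementation ¬x ∧ ¬(x → y) ≤ 0
-- says exactly that ¬(x → y) = ¬¬x ∧ ¬y, i.e. identity (3).  It also forces
-- ¬(x · y) = ¬(x ∧ y), and together these make double negation a homomorphism
-- onto the regular elements (¬¬a = a), which then form a Boolean algebra with
-- · = ∧.  Evaluating an equation valid in Boolean algebras there gives
-- ¬¬s = ¬¬t, hence ¬s = ¬t: so the integral strongly pseudo-complemented
-- algebras form a variety with the Glivenko property, giving (2) ⇒ (1).
-- Conversely, in every Boolean algebra ¬x ∧ ¬(x → y) ∧ 0 = ¬x ∧ ¬(x → y),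
-- so the Glivenko property yields ¬(a ∧ 0) = ¬a for a = ¬x ∧ ¬(x → y); the
-- left side is 1 by integrality, whence a ≤ 0, which is (1) ⇒ (2).

module Submission where

open import Defs
open import Axiom.UniquenessOfIdentityProofs.WithK using (uip)
open import Data.Nat using (ℕ; zero; suc)
open import Data.Product using (_×_; _,_; Σ; proj₁; proj₂)
open import Function.Bundles using (_⇔_; mk⇔; Equivalence)
open import Relation.Binary.Bundles using (Poset)
open import Relation.Binary.Structures using (IsPartialOrder)
open import Relation.Binary.PropositionalEquality
import Relation.Binary.Reasoning.PartialOrder as PartialOrderReasoning

module Properties (A : FLe) where
  open FLe A

  ¬¬_ : Carrier A → Carrier A
  ¬¬ x = ¬ₐ (¬ₐ x)

  ∧-idem : ∀ x → x ∧ x ≡ x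
  ∧-idem x = trans (cong (x ∧_) (sym (∨-absorbs-∧ x x))) (∧-absorbs-∨ x (x ∧ x))

  ≤-refl : ∀ {x} → x ≤ x
  ≤-refl = ∧-idem _

  ≤-reflexive : ∀ {x y} → x ≡ y → x ≤ y
  ≤-reflexive refl = ≤-refl

  ≤-antisym : ∀ {x y} → x ≤ y → y ≤ x → x ≡ y
  ≤-antisym {x} {y} x≤y y≤x = trans (sym x≤y) (trans (∧-comm x y) y≤x)

  ≤-trans : ∀ {x y z} → x ≤ y → y ≤ z → x ≤ z
  ≤-trans {x} {y} {z} x≤y y≤z =
    trans (cong (_∧ z) (sym x≤y)) (trans (∧-assoc x y z) (trans (cong (x ∧_) y≤z) x≤y))

  ≤-isPartialOrder : IsPartialOrder _≡_ _≤_
  ≤-isPartialOrder = record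
    { isPreorder = record
      { isEquivalence = isEquivalence
      ; reflexive = ≤-reflexive
      ; trans = ≤-trans
      }
    ; antisym = ≤-antisym
    }

  ≤-poset : Poset _ _ _
  ≤-poset = record { isPartialOrder = ≤-isPartialOrder }

  module ≤-Reasoning = PartialOrderReasoning ≤-poset

  ≤-respˡ-≡ : ∀ {x x′ y} → x ≡ x′ → x ≤ y → x′ ≤ y
  ≤-respˡ-≡ refl x≤y = x≤y

  ≤-respʳ-≡ : ∀ {x y y′} → y ≡ y′ → x ≤ y → x ≤ y′
  ≤-respʳ-≡ refl x≤y = x≤y

  x∧y≤x : ∀ x y → x ∧ y ≤ x
  x∧y≤x x y = begin-equality
    (x ∧ y) ∧ x   ≡⟨ cong (_∧ x) (∧-comm x y) ⟩
    (y ∧ x) ∧ x   ≡⟨ ∧-assoc y x x ⟩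
    y ∧ (x ∧ x)   ≡⟨ cong (y ∧_) (∧-idem x) ⟩
    y ∧ x         ≡⟨ ∧-comm y x ⟩
    x ∧ y         ∎
    where open ≤-Reasoning

  x∧y≤y : ∀ x y → x ∧ y ≤ y
  x∧y≤y x y = trans (∧-assoc x y y) (cong (x ∧_) (∧-idem y))

  ∧-greatest : ∀ {x y z} → z ≤ x → z ≤ y → z ≤ x ∧ y
  ∧-greatest {x} {y} {z} z≤x z≤y = trans (sym (∧-assoc z x y)) (trans (cong (_∧ y) z≤x) z≤y)

  ∧-mono-≤ : ∀ {x x′ y y′} → x ≤ x′ → y ≤ y′ → x ∧ y ≤ x′ ∧ y′
  ∧-mono-≤ {x} {x′} {y} {y′} x≤x′ y≤y′ =
    ∧-greatest (≤-trans (x∧y≤x x y) x≤x′) (≤-trans (x∧y≤y x y) y≤y′)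

  x≤x∨y : ∀ x y → x ≤ x ∨ y
  x≤x∨y = ∧-absorbs-∨

  y≤x∨y : ∀ x y → y ≤ x ∨ y
  y≤x∨y x y = ≤-respʳ-≡ (∨-comm y x) (x≤x∨y y x)

  ≤⇒∨≡ : ∀ {x y} → x ≤ y → x ∨ y ≡ y
  ≤⇒∨≡ {x} {y} x≤y =
    trans (cong (_∨ y) (sym x≤y))
      (trans (∨-comm (x ∧ y) y) (trans (cong (y ∨_) (∧-comm x y)) (∨-absorbs-∧ y x)))

  ∨-least : ∀ {x y z} → x ≤ z → y ≤ z → x ∨ y ≤ z
  ∨-least {x} {y} {z} x≤z y≤z =
    trans (cong ((x ∨ y) ∧_) (sym z≡x∨y∨z)) (∧-absorbs-∨ (x ∨ y) z)
    where
    z≡x∨y∨z : (x ∨ y) ∨ z ≡ z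
    z≡x∨y∨z = trans (∨-assoc x y z) (trans (cong (x ∨_) (≤⇒∨≡ y≤z)) (≤⇒∨≡ x≤z))

  curry : ∀ {x y z} → x · y ≤ z → x ≤ y ⇒ z
  curry {x} {y} {z} = Equivalence.to (residuated x y z)

  uncurry : ∀ {x y z} → x ≤ y ⇒ z → x · y ≤ z
  uncurry {x} {y} {z} = Equivalence.from (residuated x y z)

  modus-ponens : ∀ x y → (x ⇒ y) · x ≤ y
  modus-ponens x y = uncurry ≤-refl

  ⇒-swap : ∀ {x y z} → x ≤ y ⇒ z → y ≤ x ⇒ z
  ⇒-swap {x} {y} x≤y⇒z = curry (≤-respˡ-≡ (·-comm x y) (uncurry x≤y⇒z))

  ·-identityʳ : ∀ x → x · 𝟙 ≡ x
  ·-identityʳ x = trans (·-comm x 𝟙) (·-identityˡ x)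

  ·-monoˡ-≤ : ∀ {x x′ y} → x ≤ x′ → x · y ≤ x′ · y
  ·-monoˡ-≤ x≤x′ = uncurry (≤-trans x≤x′ (curry ≤-refl))

  ·-monoʳ-≤ : ∀ {x y y′} → y ≤ y′ → x · y ≤ x · y′
  ·-monoʳ-≤ {x} {y} {y′} y≤y′ = ≤-respˡ-≡ (·-comm y x) (≤-respʳ-≡ (·-comm y′ x) (·-monoˡ-≤ y≤y′))

  ⇒-curry : ∀ x y z → (x ⇒ (y ⇒ z)) ≡ (x · y ⇒ z)
  ⇒-curry x y z = ≤-antisym
    (curry (≤-respˡ-≡ (·-assoc (x ⇒ (y ⇒ z)) x y) (uncurry (modus-ponens x (y ⇒ z)))))
    (curry (curry (≤-respˡ-≡ (sym (·-assoc (x · y ⇒ z) x y)) (modus-ponens (x · y) z))))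

  x≤¬¬x : ∀ x → x ≤ ¬¬ x
  x≤¬¬x x = ⇒-swap ≤-refl

  ¬-antitone : ∀ {x y} → x ≤ y → ¬ₐ y ≤ ¬ₐ x
  ¬-antitone {x} {y} x≤y = ⇒-swap (≤-trans x≤y (x≤¬¬x y))

  ¬¬-mono : ∀ {x y} → x ≤ y → ¬¬ x ≤ ¬¬ y
  ¬¬-mono x≤y = ¬-antitone (¬-antitone x≤y)

  ¬¬¬x≡¬x : ∀ x → ¬ₐ (¬¬ x) ≡ ¬ₐ x
  ¬¬¬x≡¬x x = ≤-antisym (¬-antitone (x≤¬¬x x)) (x≤¬¬x (¬ₐ x))

  ¬-∨ : ∀ x y → ¬ₐ (x ∨ y) ≡ ¬ₐ x ∧ ¬ₐ y
  ¬-∨ x y = ≤-antisym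
    (∧-greatest (¬-antitone (x≤x∨y x y)) (¬-antitone (y≤x∨y x y)))
    (⇒-swap (∨-least (⇒-swap (x∧y≤x (¬ₐ x) (¬ₐ y))) (⇒-swap (x∧y≤y (¬ₐ x) (¬ₐ y)))))

  ¬-∨-¬¬ˡ : ∀ x y → ¬ₐ (¬¬ x ∨ y) ≡ ¬ₐ (x ∨ y)
  ¬-∨-¬¬ˡ x y = trans (¬-∨ (¬¬ x) y) (trans (cong (_∧ ¬ₐ y) (¬¬¬x≡¬x x)) (sym (¬-∨ x y)))

  ¬-∨-¬¬ʳ : ∀ x y → ¬ₐ (x ∨ ¬¬ y) ≡ ¬ₐ (x ∨ y)
  ¬-∨-¬¬ʳ x y = trans (cong ¬ₐ (∨-comm x (¬¬ y)))
    (trans (¬-∨-¬¬ˡ y x) (cong ¬ₐ (∨-comm y x)))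

  ¬-· : ∀ x y → ¬ₐ (x · y) ≡ (x ⇒ ¬ₐ y)
  ¬-· x y = sym (⇒-curry x y 𝟘)

  ¬¬-·-lax : ∀ x y → ¬¬ x · ¬¬ y ≤ ¬¬ (x · y)
  ¬¬-·-lax x y = curry (≤-respˡ-≡ (sym (·-assoc (¬¬ x) (¬¬ y) (¬ₐ (x · y))))
    (≤-trans (·-monoʳ-≤ ¬¬y·¬xy≤¬x) (modus-ponens (¬ₐ x) 𝟘)))
    where
    ¬xy·x≤¬y : ¬ₐ (x · y) · x ≤ ¬ₐ y
    ¬xy·x≤¬y = uncurry (≤-reflexive (¬-· x y))
    ¬¬y·¬xy≤¬x : ¬¬ y · ¬ₐ (x · y) ≤ ¬ₐ x
    ¬¬y·¬xy≤¬x = curry (≤-respˡ-≡ (sym (·-assoc (¬¬ y) (¬ₐ (x · y)) x))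
      (≤-trans (·-monoʳ-≤ ¬xy·x≤¬y) (modus-ponens (¬ₐ y) 𝟘)))

  ¬𝟙≡𝟘 : ¬ₐ 𝟙 ≡ 𝟘
  ¬𝟙≡𝟘 = ≤-antisym
    (≤-respˡ-≡ (·-identityʳ (¬ₐ 𝟙)) (modus-ponens 𝟙 𝟘))
    (curry (≤-reflexive (·-identityʳ 𝟘)))

  𝟙≤¬x⇒x≤𝟘 : ∀ {x} → 𝟙 ≤ ¬ₐ x → x ≤ 𝟘
  𝟙≤¬x⇒x≤𝟘 {x} 𝟙≤¬x = ≤-respˡ-≡ (·-identityˡ x) (uncurry 𝟙≤¬x)

  x≤𝟘⇒𝟙≤¬x : ∀ {x} → x ≤ 𝟘 → 𝟙 ≤ ¬ₐ x
  x≤𝟘⇒𝟙≤¬x {x} x≤𝟘 = curry (≤-respˡ-≡ (sym (·-identityˡ x)) x≤𝟘)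

module IntegralProperties (A : FLe) (integral : Integral A) where
  open FLe A
  open Properties A

  x·y≤x : ∀ x y → x · y ≤ x
  x·y≤x x y = ≤-respʳ-≡ (·-identityʳ x) (·-monoʳ-≤ (integral y))

  x·y≤y : ∀ x y → x · y ≤ y
  x·y≤y x y = ≤-respˡ-≡ (·-comm y x) (x·y≤x y x)

  x·y≤x∧y : ∀ x y → x · y ≤ x ∧ y
  x·y≤x∧y x y = ∧-greatest (x·y≤x x y) (x·y≤y x y)

  ¬≡𝟙⇒≤𝟘 : ∀ {x} → ¬ₐ x ≡ 𝟙 → x ≤ 𝟘
  ¬≡𝟙⇒≤𝟘 ¬x≡𝟙 = 𝟙≤¬x⇒x≤𝟘 (≤-reflexive (sym ¬x≡𝟙))

  ≤𝟘⇒¬≡𝟙 : ∀ {x} → x ≤ 𝟘 → ¬ₐ x ≡ 𝟙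
  ≤𝟘⇒¬≡𝟙 x≤𝟘 = ≤-antisym (integral _) (x≤𝟘⇒𝟙≤¬x x≤𝟘)

  ¬𝟘≡𝟙 : ¬ₐ 𝟘 ≡ 𝟙
  ¬𝟘≡𝟙 = ≤𝟘⇒¬≡𝟙 ≤-refl

  ⇒-refl : ∀ x → (x ⇒ x) ≡ 𝟙
  ⇒-refl x = ≤-antisym (integral _) (curry (≤-reflexive (·-identityˡ x)))

negImp⇒spc : (A : FLe) → Integral A → NegImpIdentity A → StronglyPseudoComplemented A
negImp⇒spc A integral negImp x y = begin
  ¬ₐ x ∧ ¬ₐ (x ⇒ y)          ≤⟨ ∧-mono-≤ ≤-refl ¬[x⇒y]≤¬¬x ⟩
  ¬ₐ x ∧ ¬¬ x                ≡⟨ ¬x∧¬¬x≡𝟘 ⟩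
  𝟘                          ∎
  where
  open FLe A
  open Properties A
  open IntegralProperties A integral
  open ≤-Reasoning
  ¬[x⇒y]≤¬¬x : ¬ₐ (x ⇒ y) ≤ ¬¬ x
  ¬[x⇒y]≤¬¬x = ≤-respˡ-≡ (sym (trans (negImp x y) (¬-∨ (¬ₐ x) y))) (x∧y≤x _ _)
  ¬x∧¬¬x≡𝟘 : ¬ₐ x ∧ ¬¬ x ≡ 𝟘
  ¬x∧¬¬x≡𝟘 = begin-equality
    ¬ₐ x ∧ ¬¬ x            ≡⟨ ∧-comm (¬ₐ x) (¬¬ x) ⟩
    ¬¬ x ∧ ¬ₐ x            ≡⟨ ¬-∨ (¬ₐ x) x ⟨
    ¬ₐ (¬ₐ x ∨ x)          ≡⟨ negImp x x ⟨
    ¬ₐ (x ⇒ x)             ≡⟨ cong ¬ₐ (⇒-refl x) ⟩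
    ¬ₐ 𝟙                   ≡⟨ ¬𝟙≡𝟘 ⟩
    𝟘                      ∎

module StronglyPseudoComplementedProperties
  (A : FLe) (integral : Integral A) (spc : StronglyPseudoComplemented A) where
  open FLe A
  open Properties A
  open IntegralProperties A integral
  open ≤-Reasoning

  x∧¬x≤𝟘 : ∀ x → x ∧ ¬ₐ x ≤ 𝟘
  x∧¬x≤𝟘 x = begin
    x ∧ ¬ₐ x        ≤⟨ ∧-mono-≤ (x≤¬¬x x) ≤-refl ⟩
    ¬¬ x ∧ ¬ₐ x     ≡⟨ ∧-comm (¬¬ x) (¬ₐ x) ⟩
    ¬ₐ x ∧ ¬¬ x     ≤⟨ spc x 𝟘 ⟩
    𝟘               ∎

  ¬-·≡¬-∧ : ∀ x y → ¬ₐ (x · y) ≡ ¬ₐ (x ∧ y)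
  ¬-·≡¬-∧ x y = ≤-antisym (curry z·[x∧y]≤𝟘) (¬-antitone (x·y≤x∧y x y))
    where
    z = ¬ₐ (x · y)
    z·[x∧y]≤𝟘 : z · (x ∧ y) ≤ 𝟘
    z·[x∧y]≤𝟘 = begin
      z · (x ∧ y)   ≤⟨ ∧-greatest (≤-trans (·-monoʳ-≤ (x∧y≤y x y)) (x·y≤y z y))
                                  (≤-trans (·-monoʳ-≤ (x∧y≤x x y)) (uncurry (≤-reflexive (¬-· x y)))) ⟩
      y ∧ ¬ₐ y      ≤⟨ x∧¬x≤𝟘 y ⟩
      𝟘             ∎

  negImp : NegImpIdentity A
  negImp x y = trans (≤-antisym ¬[x⇒y]≤¬¬x∧¬y ¬¬x∧¬y≤¬[x⇒y]) (sym (¬-∨ (¬ₐ x) y))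
    where
    ¬[x⇒y]≤¬¬x∧¬y : ¬ₐ (x ⇒ y) ≤ ¬¬ x ∧ ¬ₐ y
    ¬[x⇒y]≤¬¬x∧¬y = ∧-greatest
      (curry (≤-trans (x·y≤x∧y _ _) (≤-respˡ-≡ (∧-comm (¬ₐ x) (¬ₐ (x ⇒ y))) (spc x y))))
      (¬-antitone (curry (x·y≤x y x)))
    c = ¬¬ x ∧ ¬ₐ y
    c·[x⇒y]·x≤𝟘 : c · (x ⇒ y) · x ≤ 𝟘
    c·[x⇒y]·x≤𝟘 = begin
      c · (x ⇒ y) · x     ≡⟨ ·-assoc c (x ⇒ y) x ⟩
      c · ((x ⇒ y) · x)   ≤⟨ ·-monoʳ-≤ (modus-ponens x y) ⟩
      c · y               ≤⟨ ·-monoˡ-≤ (x∧y≤y (¬¬ x) (¬ₐ y)) ⟩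
      ¬ₐ y · y            ≤⟨ modus-ponens y 𝟘 ⟩
      𝟘                   ∎
    ¬¬x∧¬y≤¬[x⇒y] : c ≤ ¬ₐ (x ⇒ y)
    ¬¬x∧¬y≤¬[x⇒y] = curry (begin
      c · (x ⇒ y)         ≤⟨ ∧-greatest (curry c·[x⇒y]·x≤𝟘) (≤-trans (x·y≤x c (x ⇒ y)) (x∧y≤x _ _)) ⟩
      ¬ₐ x ∧ ¬¬ x         ≤⟨ spc x 𝟘 ⟩
      𝟘                   ∎)

  ¬¬-· : ∀ x y → ¬¬ (x · y) ≡ ¬¬ (x ∧ y)
  ¬¬-· x y = cong ¬ₐ (¬-·≡¬-∧ x y)

  ¬¬-∧ : ∀ x y → ¬¬ (x ∧ y) ≡ ¬¬ x ∧ ¬¬ y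
  ¬¬-∧ x y = ≤-antisym
    (∧-greatest (¬¬-mono (x∧y≤x x y)) (¬¬-mono (x∧y≤y x y)))
    (begin
      ¬¬ x ∧ ¬¬ y             ≤⟨ x≤¬¬x _ ⟩
      ¬¬ (¬¬ x ∧ ¬¬ y)        ≡⟨ ¬¬-· (¬¬ x) (¬¬ y) ⟨
      ¬¬ (¬¬ x · ¬¬ y)        ≤⟨ ¬¬-mono (¬¬-·-lax x y) ⟩
      ¬¬ (¬¬ (x · y))         ≡⟨ cong ¬ₐ (¬¬¬x≡¬x (x · y)) ⟩
      ¬¬ (x · y)              ≡⟨ ¬¬-· x y ⟩
      ¬¬ (x ∧ y)              ∎)

  ¬¬-⇒ : ∀ x y → ¬¬ (x ⇒ y) ≡ (¬¬ x ⇒ ¬¬ y)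
  ¬¬-⇒ x y = begin-equality
    ¬¬ (x ⇒ y)              ≡⟨ cong ¬ₐ (negImp x y) ⟩
    ¬¬ (¬ₐ x ∨ y)           ≡⟨ cong ¬ₐ (¬-∨ (¬ₐ x) y) ⟩
    ¬ₐ (¬¬ x ∧ ¬ₐ y)        ≡⟨ ¬-·≡¬-∧ (¬¬ x) (¬ₐ y) ⟨
    ¬ₐ (¬¬ x · ¬ₐ y)        ≡⟨ ⇒-curry (¬¬ x) (¬ₐ y) 𝟘 ⟨
    (¬¬ x ⇒ ¬¬ y)           ∎

  ¬¬-∨ : ∀ x y → ¬¬ (¬¬ x ∨ ¬¬ y) ≡ ¬¬ (x ∨ y)
  ¬¬-∨ x y = cong ¬ₐ (trans (¬-∨-¬¬ˡ x (¬¬ y)) (¬-∨-¬¬ʳ x y))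

  ¬¬𝟘≡𝟘 : ¬¬ 𝟘 ≡ 𝟘
  ¬¬𝟘≡𝟘 = trans (cong ¬ₐ ¬𝟘≡𝟙) ¬𝟙≡𝟘

  ¬¬𝟙≡𝟙 : ¬¬ 𝟙 ≡ 𝟙
  ¬¬𝟙≡𝟙 = trans (cong ¬ₐ ¬𝟙≡𝟘) ¬𝟘≡𝟙

module RegularElements
  (A : FLe) (integral : Integral A) (spc : StronglyPseudoComplemented A) where
  open FLe A
  open Properties A
  open IntegralProperties A integral
  open StronglyPseudoComplementedProperties A integral spc

  Regular : Set
  Regular = Σ (FLe.Carrier A) (λ a → ¬¬ a ≡ a)

  regular-≡ : {a b : Regular} → proj₁ a ≡ proj₁ b → a ≡ b
  regular-≡ {a , p} {.a , q} refl = cong (a ,_) (uip p q)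

  ¬¬-regular : FLe.Carrier A → Regular
  ¬¬-regular a = ¬¬ a , cong ¬ₐ (¬¬¬x≡¬x a)

  _∧ʳ_ _∨ʳ_ _⇒ʳ_ : Regular → Regular → Regular
  (a , ¬¬a≡a) ∧ʳ (b , ¬¬b≡b) = a ∧ b , trans (¬¬-∧ a b) (cong₂ _∧_ ¬¬a≡a ¬¬b≡b)
  (a , _) ∨ʳ (b , _) = ¬¬-regular (a ∨ b)
  (a , ¬¬a≡a) ⇒ʳ (b , ¬¬b≡b) = (a ⇒ b) , trans (¬¬-⇒ a b) (cong₂ _⇒_ ¬¬a≡a ¬¬b≡b)

  regular-∨-assoc : ∀ a b c → ¬¬ (¬¬ (a ∨ b) ∨ c) ≡ ¬¬ (a ∨ ¬¬ (b ∨ c))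
  regular-∨-assoc a b c = cong ¬ₐ (begin
    ¬ₐ (¬¬ (a ∨ b) ∨ c)   ≡⟨ ¬-∨-¬¬ˡ (a ∨ b) c ⟩
    ¬ₐ ((a ∨ b) ∨ c)      ≡⟨ cong ¬ₐ (∨-assoc a b c) ⟩
    ¬ₐ (a ∨ (b ∨ c))      ≡⟨ ¬-∨-¬¬ʳ a (b ∨ c) ⟨
    ¬ₐ (a ∨ ¬¬ (b ∨ c))   ∎)
    where open ≡-Reasoning

  regularAlgebra : FLe
  regularAlgebra = record
    { Carrier = Regular
    ; _∧_ = _∧ʳ_
    ; _∨_ = _∨ʳ_
    ; _·_ = _∧ʳ_
    ; _⇒_ = _⇒ʳ_
    ; 𝟘 = 𝟘 , ¬¬𝟘≡𝟘
    ; 𝟙 = 𝟙 , ¬¬𝟙≡𝟙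
    ; ∧-assoc = λ _ _ _ → regular-≡ (∧-assoc _ _ _)
    ; ∨-assoc = λ a b c → regular-≡ (regular-∨-assoc (proj₁ a) (proj₁ b) (proj₁ c))
    ; ∧-comm = λ _ _ → regular-≡ (∧-comm _ _)
    ; ∨-comm = λ a b → regular-≡ (cong ¬¬_ (∨-comm (proj₁ a) (proj₁ b)))
    ; ∧-absorbs-∨ = λ a b → regular-≡ (≤-trans (x≤x∨y (proj₁ a) (proj₁ b)) (x≤¬¬x _))
    ; ∨-absorbs-∧ = λ a b → regular-≡ (trans (cong ¬¬_ (∨-absorbs-∧ _ _)) (proj₂ a))
    ; ·-assoc = λ _ _ _ → regular-≡ (∧-assoc _ _ _)
    ; ·-comm = λ _ _ → regular-≡ (∧-comm _ _)
    ; ·-identityˡ = λ a → regular-≡ (trans (∧-comm 𝟙 (proj₁ a)) (integral (proj₁ a)))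
    ; residuated = λ a b c → mk⇔
        (λ a∧b≤c → regular-≡ (curry (≤-trans (x·y≤x∧y _ _) (cong proj₁ a∧b≤c))))
        (λ a≤b⇒c → regular-≡ (a·b≤c⇒a∧b≤c a b c (uncurry (cong proj₁ a≤b⇒c))))
    }
    where
    a·b≤c⇒a∧b≤c : ∀ a b c → proj₁ a · proj₁ b ≤ proj₁ c → proj₁ a ∧ proj₁ b ≤ proj₁ c
    a·b≤c⇒a∧b≤c (a , _) (b , _) (c , ¬¬c≡c) a·b≤c = begin
      a ∧ b          ≤⟨ x≤¬¬x (a ∧ b) ⟩
      ¬¬ (a ∧ b)     ≡⟨ ¬¬-· a b ⟨
      ¬¬ (a · b)     ≤⟨ ¬¬-mono a·b≤c ⟩
      ¬¬ c           ≡⟨ ¬¬c≡c ⟩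
      c              ∎
      where open ≤-Reasoning

  regularAlgebra-isBA : IsBA regularAlgebra
  regularAlgebra-isBA =
    (λ _ _ → refl) ,
    (λ a b → regular-≡ (trans (sym (proj₂ (a ⇒ʳ b))) (cong ¬ₐ (negImp (proj₁ a) (proj₁ b)))))

  ⟦⟧-¬¬ : ∀ t v → proj₁ (⟦ t ⟧ regularAlgebra (λ i → ¬¬-regular (v i))) ≡ ¬¬ (⟦ t ⟧ A v)
  ⟦⟧-¬¬ (var i) v = refl
  ⟦⟧-¬¬ (s ∧ₜ t) v = trans (cong₂ _∧_ (⟦⟧-¬¬ s v) (⟦⟧-¬¬ t v)) (sym (¬¬-∧ _ _))
  ⟦⟧-¬¬ (s ∨ₜ t) v = trans (cong₂ (λ a b → ¬¬ (a ∨ b)) (⟦⟧-¬¬ s v) (⟦⟧-¬¬ t v)) (¬¬-∨ _ _)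
  ⟦⟧-¬¬ (s ·ₜ t) v = trans (cong₂ _∧_ (⟦⟧-¬¬ s v) (⟦⟧-¬¬ t v)) (trans (sym (¬¬-∧ _ _)) (sym (¬¬-· _ _)))
  ⟦⟧-¬¬ (s ⇒ₜ t) v = trans (cong₂ _⇒_ (⟦⟧-¬¬ s v) (⟦⟧-¬¬ t v)) (sym (¬¬-⇒ _ _))
  ⟦⟧-¬¬ 𝟘ₜ v = sym ¬¬𝟘≡𝟘
  ⟦⟧-¬¬ 𝟙ₜ v = sym ¬¬𝟙≡𝟙

  BA⊨⇒⊨¬ : ∀ s t → BA⊨ s ≈ t → A ⊨ ¬ₜ s ≈ ¬ₜ t
  BA⊨⇒⊨¬ s t BA⊨s≈t v = begin
    ¬ₐ (⟦ s ⟧ A v)          ≡⟨ ¬¬¬x≡¬x _ ⟨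
    ¬ₐ (¬¬ ⟦ s ⟧ A v)       ≡⟨ cong ¬ₐ (⟦⟧-¬¬ s v) ⟨
    ¬ₐ (proj₁ (⟦ s ⟧ regularAlgebra v′))
      ≡⟨ cong (λ r → ¬ₐ (proj₁ r)) (BA⊨s≈t regularAlgebra regularAlgebra-isBA v′) ⟩
    ¬ₐ (proj₁ (⟦ t ⟧ regularAlgebra v′))
      ≡⟨ cong ¬ₐ (⟦⟧-¬¬ t v) ⟩
    ¬ₐ (¬¬ ⟦ t ⟧ A v)       ≡⟨ ¬¬¬x≡¬x _ ⟩
    ¬ₐ (⟦ t ⟧ A v)          ∎
    where
    open ≡-Reasoning
    v′ : ℕ → Regular
    v′ i = ¬¬-regular (v i)

module BooleanProperties (B : FLe) (isBA : IsBA B) where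
  open FLe B
  open Properties B

  ·≡∧ : ∀ x y → x · y ≡ x ∧ y
  ·≡∧ = proj₁ isBA

  ⇒≡¬∨ : ∀ x y → (x ⇒ y) ≡ ¬ₐ x ∨ y
  ⇒≡¬∨ = proj₂ isBA

  integral : Integral B
  integral x = trans (sym (·≡∧ x 𝟙)) (·-identityʳ x)

  open IntegralProperties B integral

  spc : StronglyPseudoComplemented B
  spc x y = begin
    ¬ₐ x ∧ ¬ₐ (x ⇒ y)        ≤⟨ ∧-mono-≤ (≤-respʳ-≡ (sym (⇒≡¬∨ x y)) (x≤x∨y (¬ₐ x) y)) ≤-refl ⟩
    (x ⇒ y) ∧ ¬ₐ (x ⇒ y)     ≡⟨ ·≡∧ (x ⇒ y) (¬ₐ (x ⇒ y)) ⟨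
    (x ⇒ y) · ¬ₐ (x ⇒ y)     ≡⟨ ·-comm (x ⇒ y) (¬ₐ (x ⇒ y)) ⟩
    ¬ₐ (x ⇒ y) · (x ⇒ y)     ≤⟨ modus-ponens (x ⇒ y) 𝟘 ⟩
    𝟘                        ∎
    where open ≤-Reasoning

  ¬¬x≡x : ∀ x → ¬¬ x ≡ x
  ¬¬x≡x x = ≤-antisym (≤-respˡ-≡ (·-identityˡ (¬¬ x)) (uncurry 𝟙≤¬¬x⇒x)) (x≤¬¬x x)
    where
    ¬¬x⇒x≡x⇒x : (¬¬ x ⇒ x) ≡ (x ⇒ x)
    ¬¬x⇒x≡x⇒x = trans (⇒≡¬∨ (¬¬ x) x) (trans (cong (_∨ x) (¬¬¬x≡¬x x)) (sym (⇒≡¬∨ x x)))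
    𝟙≤¬¬x⇒x : 𝟙 ≤ ¬¬ x ⇒ x
    𝟙≤¬¬x⇒x = ≤-reflexive (sym (trans ¬¬x⇒x≡x⇒x (⇒-refl x)))

  ¬-injective : ∀ {x y} → ¬ₐ x ≡ ¬ₐ y → x ≡ y
  ¬-injective {x} {y} ¬x≡¬y = trans (sym (¬¬x≡x x)) (trans (cong ¬ₐ ¬x≡¬y) (¬¬x≡x y))

spcₜ : Term
spcₜ = ¬ₜ (var 0) ∧ₜ ¬ₜ (var 0 ⇒ₜ var 1)

data IntegralSPC : Equations where
  x∧𝟙≈x : IntegralSPC (var 0 ∧ₜ 𝟙ₜ) (var 0)
  spcₜ∧𝟘≈spcₜ : IntegralSPC (spcₜ ∧ₜ 𝟘ₜ) spcₜ

valuation₂ : {X : Set} → X → X → ℕ → X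
valuation₂ x y zero = x
valuation₂ x y (suc _) = y

⊨IntegralSPC⇔ : (A : FLe) → A ⊨ᴱ IntegralSPC ⇔ (Integral A × StronglyPseudoComplemented A)
⊨IntegralSPC⇔ A = mk⇔
  (λ A⊨ → (λ x → A⊨ _ _ x∧𝟙≈x (λ _ → x)) ,
          (λ x y → A⊨ _ _ spcₜ∧𝟘≈spcₜ (valuation₂ x y)))
  (λ where (int , spc) _ _ x∧𝟙≈x v → int (v 0)
           (int , spc) _ _ spcₜ∧𝟘≈spcₜ v → spc (v 0) (v 1))

glivenko-IntegralSPC : GlivenkoProperty IntegralSPC
glivenko-IntegralSPC s t = mk⇔
  (λ BA⊨s≈t C C⊨ → let (int , spc) = Equivalence.to (⊨IntegralSPC⇔ C) C⊨ in
    RegularElements.BA⊨⇒⊨¬ C int spc s t BA⊨s≈t)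
  (λ Mod⊨¬s≈¬t B isBA v → let open BooleanProperties B isBA in
    ¬-injective (Mod⊨¬s≈¬t B (Equivalence.from (⊨IntegralSPC⇔ B) (integral , spc)) v))

spc⇒G-BA : (A : FLe) → Integral A → StronglyPseudoComplemented A → InG-FLe-BA A
spc⇒G-BA A int spc =
  IntegralSPC , glivenko-IntegralSPC , Equivalence.from (⊨IntegralSPC⇔ A) (int , spc)

G-BA⇒spc : (A : FLe) → Integral A → InG-FLe-BA A → StronglyPseudoComplemented A
G-BA⇒spc A int (E , glivenko , A⊨E) x y = ¬≡𝟙⇒≤𝟘 ¬a≡𝟙
  where
  open FLe A
  open Properties A
  open IntegralProperties A int
  a = ¬ₐ x ∧ ¬ₐ (x ⇒ y)
  BA⊨spc : BA⊨ (spcₜ ∧ₜ 𝟘ₜ) ≈ spcₜ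
  BA⊨spc B isBA v = BooleanProperties.spc B isBA (v 0) (v 1)
  ¬a∧𝟘≡¬a : ¬ₐ (a ∧ 𝟘) ≡ ¬ₐ a
  ¬a∧𝟘≡¬a = Equivalence.to (glivenko (spcₜ ∧ₜ 𝟘ₜ) spcₜ) BA⊨spc A A⊨E (valuation₂ x y)
  ¬a≡𝟙 : ¬ₐ a ≡ 𝟙
  ¬a≡𝟙 = trans (sym ¬a∧𝟘≡¬a) (≤𝟘⇒¬≡𝟙 (x∧y≤y a 𝟘))

lemma2p11 : (A : FLe) → Integral A →
    (InG-FLei-BA A ⇔ StronglyPseudoComplemented A)
    × (StronglyPseudoComplemented A ⇔ NegImpIdentity A)
lemma2p11 A int =
  mk⇔ (λ (A∈G , _) → G-BA⇒spc A int A∈G)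
      (λ spc → spc⇒G-BA A int spc , int) ,
  mk⇔ (StronglyPseudoComplementedProperties.negImp A int) (negImp⇒spc A int)
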